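{- There exist a finite abelian group $\Gamma$ and a subset $\Lambda\subseteq\Gamma$ such that $\Lambda$ satisfies (EP1) but not (EP2), and there exist a finite abelian group $\Gamma'$ and a subset $\Lambda'\subseteq\Gamma'$ such that $\Lambda'$ satisfies (EP2) but not (EP1). Here, for a finite abelian group $\Gamma$ and $\Lambda\subseteq\Gamma$: (EP1) for all $a,b,c\in\Gamma$, if $a+b+c\in\Lambda$, then $a+b\in\Lambda$, or $(2a+\langle c\rangle)\cap\Lambda\neq\emptyset$, or $(2b+\langle c\rangle)\cap\Lambda\neq\emptyset$; (EP2) for all $a,b,c\in\Gamma$, if $2a+b+c\in\Lambda$, then $(2a+\langle b\rangle)\cap\Lambda\neq\emptyset$ or $(2a+\langle c\rangle)\cap\Lambda\neq\emptyset$.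
   Context: Groups are written additively; $\langle c\rangle$ denotes the subgroup generated by $c$, and $x+S=\{x+s:s\in S\}$. -}

module Defs where

open import Level using (Level; _⊔_; suc)
open import Data.Nat using (ℕ)
import Data.Nat as ℕ
open import Data.Fin using (Fin)
open import Data.Integer using (ℤ; +_; -[1+_])
open import Data.Product using (Σ; ∃; _×_)
open import Data.Sum using (_⊎_)
open import Relation.Nullary using (¬_)
open import Algebra.Bundles using (AbelianGroup)
import Algebra.Definitions.RawMonoid as RawMonoidDefs

record FiniteAbelianGroup (c ℓ : Level) : Set (suc (c ⊔ ℓ)) where
  field
    abelianGroup : AbelianGroup c ℓ
  open AbelianGroup abelianGroup public
  field
    size      : ℕ
    enum      : Fin size → Carrier
    enum-surj : ∀ x → ∃ λ i → enum i ≈ x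

module _ {c ℓ : Level} (G : FiniteAbelianGroup c ℓ) where
  open FiniteAbelianGroup G
  open RawMonoidDefs rawMonoid using () renaming (_×_ to _·ℕ_)

  infixl 6 _+_
  _+_ : Carrier → Carrier → Carrier
  x + y = x ∙ y

  -_ : Carrier → Carrier
  - x = x ⁻¹

  _·ℤ_ : ℤ → Carrier → Carrier
  (+ n)      ·ℤ x = n ·ℕ x
  (-[1+ n ]) ·ℤ x = - (ℕ.suc n ·ℕ x)

  record Subset (p : Level) : Set (c ⊔ ℓ ⊔ suc p) where
    field
      mem     : Carrier → Set p
      mem-resp : ∀ {x y} → x ≈ y → mem x → mem y
  open Subset public

  MeetsCoset : ∀ {p} → Subset p → Carrier → Carrier → Set p
  MeetsCoset Λ x g = ∃ λ (k : ℤ) → mem Λ (x + (k ·ℤ g))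

  EP1 : ∀ {p} → Subset p → Set (c ⊔ p)
  EP1 Λ = ∀ a b c′ → mem Λ (a + b + c′) →
            mem Λ (a + b) ⊎ (MeetsCoset Λ (a + a) c′ ⊎ MeetsCoset Λ (b + b) c′)

  EP2 : ∀ {p} → Subset p → Set (c ⊔ p)
  EP2 Λ = ∀ a b c′ → mem Λ ((a + a) + b + c′) →
            MeetsCoset Λ (a + a) b ⊎ MeetsCoset Λ (a + a) c′

-- Both halves are witnessed by small explicit examples: Λ = {(0,0), (0,1), (1,0)} in (ℤ/3ℤ)²
-- and Λ′ = {1} in ℤ/4ℤ. If e·x = 0 for every x, each coset x + ⟨g⟩ is {x + r·g : r < e},
-- so (EP1) and (EP2) become statements about finitely many triples and finitely many
-- multiples, hence decidable; the positive properties are then checked by evaluation.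
module Submission where

open import Defs
open import Level using (Level; _⊔_; 0ℓ)
open import Function using (_∘_)
open import Data.Nat as ℕ using (ℕ; zero; suc; NonZero)
open import Data.Nat.Properties using (+-assoc; +-comm; +-identityʳ; *-comm; suc-pred)
open import Data.Nat.DivMod
  using (_%_; _mod_; m≡m%n+[m/n]*n; m%n<n; m%n%n≡m%n; m*n%n≡0; %-congˡ; %-distribˡ-+; %-distribˡ-*)
open import Data.Integer using (ℤ; +_; -[1+_])
open import Data.Fin using (Fin; toℕ; combine; remQuot)
open import Data.Fin.Properties using (toℕ-fromℕ<; remQuot-combine; any?; all?)
open import Data.Sum as Sum using (_⊎_)
open import Data.Product as Product using (Σ; ∃; _×_; _,_; proj₁; proj₂)
open import Data.Product.Properties using (≡-dec)
open import Data.Product.Relation.Binary.Pointwise.NonDependent using (Pointwise)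
open import Data.List using (List; []; _∷_)
open import Data.List.Membership.Propositional using (_∈_)
import Data.List.Membership.DecPropositional as Membership
open import Relation.Nullary using (¬_)
open import Relation.Nullary.Decidable using (Dec; map′; _→-dec_; _⊎-dec_; from-yes; from-no)
open import Relation.Unary using (Decidable)
open import Relation.Binary.Definitions using (DecidableEquality)
open import Relation.Binary.PropositionalEquality as ≡ using (_≡_)
import Relation.Binary.Construct.On as On
open import Algebra.Bundles using (AbelianGroup)
import Algebra.Construct.DirectProduct as DirectProduct
import Algebra.Properties.Monoid.Mult as MonoidMult
import Algebra.Properties.Group as GroupProperties

module Multiples {c ℓ : Level} (G : FiniteAbelianGroup c ℓ) where
  open FiniteAbelianGroup G
  private module Mult = MonoidMult monoid
  open Mult public using () renaming (_×_ to _·ℕ_)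
  open Mult using (×-congʳ; ×-congˡ; ×-homo-+; ×-assocˡ)
  open GroupProperties group using (inverseʳ-unique)
  open import Relation.Binary.Reasoning.Setoid setoid

  _·_ : ℤ → Carrier → Carrier
  _·_ = _·ℤ_ G

  ·-congʳ : ∀ k {x y} → x ≈ y → k · x ≈ k · y
  ·-congʳ (+ n)    x≈y = ×-congʳ n x≈y
  ·-congʳ -[1+ n ] x≈y = ⁻¹-cong (×-congʳ (suc n) x≈y)

  Annihilates : ℕ → Set (c ⊔ ℓ)
  Annihilates e = ∀ x → e ·ℕ x ≈ ε

  module _ (e : ℕ) .{{_ : NonZero e}} (annihilates : Annihilates e) where

    ·ℕ-mod : ∀ n g → n ·ℕ g ≈ toℕ (n mod e) ·ℕ g
    ·ℕ-mod n g = begin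
      n ·ℕ g                                 ≈⟨ ×-congˡ {g} n≡n%e+e[n/e] ⟩
      (n % e ℕ.+ e ℕ.* (n ℕ./ e)) ·ℕ g       ≈⟨ ×-homo-+ g (n % e) _ ⟩
      (n % e) ·ℕ g ∙ (e ℕ.* (n ℕ./ e)) ·ℕ g  ≈⟨ ∙-congˡ (sym (×-assocˡ g e (n ℕ./ e))) ⟩
      (n % e) ·ℕ g ∙ e ·ℕ ((n ℕ./ e) ·ℕ g)   ≈⟨ ∙-congˡ (annihilates _) ⟩
      (n % e) ·ℕ g ∙ ε                       ≈⟨ identityʳ _ ⟩
      (n % e) ·ℕ g                           ≈⟨ ×-congˡ {g} (≡.sym (toℕ-fromℕ< (m%n<n n e))) ⟩
      toℕ (n mod e) ·ℕ g                     ∎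
      where
      n≡n%e+e[n/e] : n ≡ n % e ℕ.+ e ℕ.* (n ℕ./ e)
      n≡n%e+e[n/e] = ≡.trans (m≡m%n+[m/n]*n n e) (≡.cong (n % e ℕ.+_) (*-comm (n ℕ./ e) e))

    ⁻¹-as-multiple : ∀ m g → (m ·ℕ g) ⁻¹ ≈ (ℕ.pred e ℕ.* m) ·ℕ g
    ⁻¹-as-multiple m g = sym (inverseʳ-unique (m ·ℕ g) _ (begin
      m ·ℕ g ∙ (ℕ.pred e ℕ.* m) ·ℕ g  ≈⟨ sym (×-homo-+ g m _) ⟩
      (m ℕ.+ ℕ.pred e ℕ.* m) ·ℕ g     ≈⟨ ×-congˡ {g} (≡.cong (ℕ._* m) (suc-pred e)) ⟩
      (e ℕ.* m) ·ℕ g                  ≈⟨ sym (×-assocˡ g e m) ⟩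
      e ·ℕ (m ·ℕ g)                   ≈⟨ annihilates _ ⟩
      ε                               ∎))

    ·-mod : ∀ k g → ∃ λ (r : Fin e) → k · g ≈ (+ toℕ r) · g
    ·-mod (+ n)    g = n mod e , ·ℕ-mod n g
    ·-mod -[1+ n ] g = m mod e , trans (⁻¹-as-multiple (suc n) g) (·ℕ-mod m g)
      where m = ℕ.pred e ℕ.* suc n

module DecideEP {c ℓ p : Level} (G : FiniteAbelianGroup c ℓ) (Λ : Subset G p) (mem? : Decidable (mem Λ))
                (e : ℕ) .{{_ : NonZero e}} (annihilates : Multiples.Annihilates G e) where
  open FiniteAbelianGroup G
  open Multiples G using (_·_; ·-congʳ; ·-mod)

  meetsCoset-resp : ∀ {x x′ g g′} → x ≈ x′ → g ≈ g′ → MeetsCoset G Λ x g → MeetsCoset G Λ x′ g′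
  meetsCoset-resp x≈x′ g≈g′ (k , x+kg∈Λ) = k , mem-resp Λ (∙-cong x≈x′ (·-congʳ k g≈g′)) x+kg∈Λ

  meetsCoset? : ∀ x g → Dec (MeetsCoset G Λ x g)
  meetsCoset? x g = map′ (λ (r , x+rg∈Λ) → + toℕ r , x+rg∈Λ) reduce (any? λ r → mem? (x ∙ (+ toℕ r) · g))
    where
    reduce : MeetsCoset G Λ x g → ∃ λ (r : Fin e) → mem Λ (x ∙ (+ toℕ r) · g)
    reduce (k , x+kg∈Λ) = let r , kg≈rg = ·-mod e annihilates k g in r , mem-resp Λ (∙-congˡ kg≈rg) x+kg∈Λ

  module _ {q : Level} {P : Carrier → Carrier → Carrier → Set q}
           (resp : ∀ {a a′ b b′ c c′} → a ≈ a′ → b ≈ b′ → c ≈ c′ → P a b c → P a′ b′ c′)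
           (P? : ∀ a b c → Dec (P a b c)) where

    ∀₃-from-enum : (∀ i j k → P (enum i) (enum j) (enum k)) → ∀ a b c → P a b c
    ∀₃-from-enum h a b c =
      let i , ia≈a = enum-surj a ; j , jb≈b = enum-surj b ; k , kc≈c = enum-surj c
      in resp ia≈a jb≈b kc≈c (h i j k)

    ∀₃? : Dec (∀ a b c → P a b c)
    ∀₃? = map′ ∀₃-from-enum (λ h i j k → h (enum i) (enum j) (enum k))
               (all? λ i → all? λ j → all? λ k → P? (enum i) (enum j) (enum k))

  EP1-at : Carrier → Carrier → Carrier → Set p
  EP1-at a b c = mem Λ (a ∙ b ∙ c) → mem Λ (a ∙ b) ⊎ MeetsCoset G Λ (a ∙ a) c ⊎ MeetsCoset G Λ (b ∙ b) c

  EP2-at : Carrier → Carrier → Carrier → Set p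
  EP2-at a b c = mem Λ (a ∙ a ∙ b ∙ c) → MeetsCoset G Λ (a ∙ a) b ⊎ MeetsCoset G Λ (a ∙ a) c

  EP1? : Dec (EP1 G Λ)
  EP1? = ∀₃? resp λ a b c → mem? _ →-dec (mem? _ ⊎-dec (meetsCoset? _ _ ⊎-dec meetsCoset? _ _))
    where
    resp : ∀ {a a′ b b′ c c′} → a ≈ a′ → b ≈ b′ → c ≈ c′ → EP1-at a b c → EP1-at a′ b′ c′
    resp a≈ b≈ c≈ h abc∈Λ =
      Sum.map (mem-resp Λ (∙-cong a≈ b≈))
              (Sum.map (meetsCoset-resp (∙-cong a≈ a≈) c≈) (meetsCoset-resp (∙-cong b≈ b≈) c≈))
              (h (mem-resp Λ (sym (∙-cong (∙-cong a≈ b≈) c≈)) abc∈Λ))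

  EP2? : Dec (EP2 G Λ)
  EP2? = ∀₃? resp λ a b c → mem? _ →-dec (meetsCoset? _ _ ⊎-dec meetsCoset? _ _)
    where
    resp : ∀ {a a′ b b′ c c′} → a ≈ a′ → b ≈ b′ → c ≈ c′ → EP2-at a b c → EP2-at a′ b′ c′
    resp a≈ b≈ c≈ h aabc∈Λ =
      Sum.map (meetsCoset-resp (∙-cong a≈ a≈) b≈) (meetsCoset-resp (∙-cong a≈ a≈) c≈)
              (h (mem-resp Λ (sym (∙-cong (∙-cong (∙-cong a≈ a≈) b≈) c≈)) aabc∈Λ))

n*m%n≡0%n : ∀ n m .{{_ : NonZero n}} → (n ℕ.* m) % n ≡ 0 % n
n*m%n≡0%n n m = begin
  (n ℕ.* m) % n  ≡⟨ %-congˡ (*-comm n m) ⟩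
  (m ℕ.* n) % n  ≡⟨ m*n%n≡0 m n ⟩
  0              ≡⟨ m*n%n≡0 0 n ⟨
  0 % n          ∎
  where open ≡.≡-Reasoning

module _ (n : ℕ) .{{_ : NonZero n}} where
  open ≡.≡-Reasoning

  -- Every natural number represents its residue, so addition needs no reduction, and
  -- taking -x = (n - 1)·x avoids truncated subtraction.
  ℤ/nℤ : AbelianGroup 0ℓ 0ℓ
  ℤ/nℤ = record
    { Carrier = ℕ
    ; _≈_ = λ x y → x % n ≡ y % n
    ; _∙_ = ℕ._+_
    ; ε = 0
    ; _⁻¹ = λ x → ℕ.pred n ℕ.* x
    ; isAbelianGroup = record
      { isGroup = record
        { isMonoid = record
          { isSemigroup = record
            { isMagma = record { isEquivalence = On.isEquivalence (_% n) ≡.isEquivalence ; ∙-cong = +-cong }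
            ; assoc = λ x y z → %-congˡ (+-assoc x y z) }
          ; identity = (λ _ → ≡.refl) , λ x → %-congˡ (+-identityʳ x) }
        ; inverse = inverseˡ , λ x → ≡.trans (%-congˡ (+-comm x _)) (inverseˡ x)
        ; ⁻¹-cong = *-cong (ℕ.pred n) }
      ; comm = λ x y → %-congˡ (+-comm x y) } }
    where
    +-cong : ∀ {x x′ y y′} → x % n ≡ x′ % n → y % n ≡ y′ % n → (x ℕ.+ y) % n ≡ (x′ ℕ.+ y′) % n
    +-cong {x} {x′} {y} {y′} x≡x′ y≡y′ = begin
      (x ℕ.+ y) % n            ≡⟨ %-distribˡ-+ x y n ⟩
      (x % n ℕ.+ y % n) % n    ≡⟨ ≡.cong₂ (λ u v → (u ℕ.+ v) % n) x≡x′ y≡y′ ⟩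
      (x′ % n ℕ.+ y′ % n) % n  ≡⟨ %-distribˡ-+ x′ y′ n ⟨
      (x′ ℕ.+ y′) % n          ∎

    *-cong : ∀ m {x y} → x % n ≡ y % n → (m ℕ.* x) % n ≡ (m ℕ.* y) % n
    *-cong m {x} {y} x≡y = begin
      (m ℕ.* x) % n              ≡⟨ %-distribˡ-* m x n ⟩
      (m % n ℕ.* (x % n)) % n    ≡⟨ ≡.cong (λ u → (m % n ℕ.* u) % n) x≡y ⟩
      (m % n ℕ.* (y % n)) % n    ≡⟨ %-distribˡ-* m y n ⟨
      (m ℕ.* y) % n              ∎

    inverseˡ : ∀ x → (ℕ.pred n ℕ.* x ℕ.+ x) % n ≡ 0 % n
    inverseˡ x = begin
      (ℕ.pred n ℕ.* x ℕ.+ x) % n  ≡⟨ %-congˡ (+-comm _ x) ⟩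
      (suc (ℕ.pred n) ℕ.* x) % n  ≡⟨ %-congˡ (≡.cong (ℕ._* x) (suc-pred n)) ⟩
      (n ℕ.* x) % n               ≡⟨ n*m%n≡0%n n x ⟩
      0 % n                       ∎

ℤ/_ℤ : (n : ℕ) .{{_ : NonZero n}} → FiniteAbelianGroup 0ℓ 0ℓ
ℤ/ n ℤ = record
  { abelianGroup = ℤ/nℤ n
  ; size = n
  ; enum = toℕ
  ; enum-surj = λ x → x mod n , ≡.trans (%-congˡ (toℕ-fromℕ< (m%n<n x n))) (m%n%n≡m%n x n) }

ℤ/nℤ-annihilated : (n : ℕ) .{{_ : NonZero n}} → Multiples.Annihilates ℤ/ n ℤ n
ℤ/nℤ-annihilated n x = begin
  (n ·ℕ x) % n   ≡⟨ %-congˡ (·ℕ≡* n) ⟩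
  (n ℕ.* x) % n  ≡⟨ n*m%n≡0%n n x ⟩
  0 % n          ∎
  where
  open ≡.≡-Reasoning
  open Multiples ℤ/ n ℤ using (_·ℕ_)
  ·ℕ≡* : ∀ m → m ·ℕ x ≡ m ℕ.* x
  ·ℕ≡* zero    = ≡.refl
  ·ℕ≡* (suc m) = ≡.cong (x ℕ.+_) (·ℕ≡* m)

module _ {c ℓ c′ ℓ′ : Level} (G : FiniteAbelianGroup c ℓ) (H : FiniteAbelianGroup c′ ℓ′) where
  private
    module G = FiniteAbelianGroup G
    module H = FiniteAbelianGroup H

  infixr 5 _⊕_
  _⊕_ : FiniteAbelianGroup (c ⊔ c′) (ℓ ⊔ ℓ′)
  _⊕_ = record
    { abelianGroup = DirectProduct.abelianGroup G.abelianGroup H.abelianGroup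
    ; size = G.size ℕ.* H.size
    ; enum = enum
    ; enum-surj = enum-surj }
    where
    enum : Fin (G.size ℕ.* H.size) → G.Carrier × H.Carrier
    enum = Product.map G.enum H.enum ∘ remQuot H.size

    enum-surj : ∀ p → ∃ λ k → Pointwise G._≈_ H._≈_ (enum k) p
    enum-surj (x , y) =
      let i , i≈x = G.enum-surj x ; j , j≈y = H.enum-surj y
      in combine i j , ≡.subst (λ q → Pointwise G._≈_ H._≈_ (Product.map G.enum H.enum q) (x , y))
                               (≡.sym (remQuot-combine i j)) (i≈x , j≈y)

  ⊕-annihilated : ∀ e → Multiples.Annihilates G e → Multiples.Annihilates H e → Multiples.Annihilates _⊕_ e
  ⊕-annihilated e G-annihilated H-annihilated (x , y) =
      G.trans (G.reflexive (proj₁-·ℕ e)) (G-annihilated x)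
    , H.trans (H.reflexive (proj₂-·ℕ e)) (H-annihilated y)
    where
    open Multiples _⊕_ using (_·ℕ_)
    open Multiples G using () renaming (_·ℕ_ to _·ᴳ_)
    open Multiples H using () renaming (_·ℕ_ to _·ᴴ_)

    proj₁-·ℕ : ∀ m → proj₁ (m ·ℕ (x , y)) ≡ m ·ᴳ x
    proj₁-·ℕ zero    = ≡.refl
    proj₁-·ℕ (suc m) = ≡.cong (x G.∙_) (proj₁-·ℕ m)

    proj₂-·ℕ : ∀ m → proj₂ (m ·ℕ (x , y)) ≡ m ·ᴴ y
    proj₂-·ℕ zero    = ≡.refl
    proj₂-·ℕ (suc m) = ≡.cong (y H.∙_) (proj₂-·ℕ m)

module ListSubset {c ℓ a : Level} (G : FiniteAbelianGroup c ℓ) {A : Set a} (_≟_ : DecidableEquality A)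
                  (rep : FiniteAbelianGroup.Carrier G → A)
                  (rep-resp : ∀ {x y} → FiniteAbelianGroup._≈_ G x y → rep x ≡ rep y)
                  (L : List A) where

  subset : Subset G a
  subset = record { mem = λ x → rep x ∈ L ; mem-resp = λ x≈y → ≡.subst (_∈ L) (rep-resp x≈y) }

  ∈? : Decidable (mem subset)
  ∈? x = Membership._∈?_ _≟_ (rep x) L

Γ : FiniteAbelianGroup 0ℓ 0ℓ
Γ = ℤ/ 3 ℤ ⊕ ℤ/ 3 ℤ

module Λ = ListSubset Γ (≡-dec ℕ._≟_ ℕ._≟_) (Product.map (_% 3) (_% 3)) (Product.uncurry (≡.cong₂ _,_))
                      ((0 , 0) ∷ (0 , 1) ∷ (1 , 0) ∷ [])

Λ : Subset Γ 0ℓ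
Λ = Λ.subset

module EP-Λ = DecideEP Γ Λ Λ.∈? 3 (⊕-annihilated (ℤ/ 3 ℤ) (ℤ/ 3 ℤ) 3 (ℤ/nℤ-annihilated 3) (ℤ/nℤ-annihilated 3))

Λ-EP1 : EP1 Γ Λ
Λ-EP1 = from-yes EP-Λ.EP1?

-- 2a + b + c = (0,0), while (0,2) + ⟨(1,0)⟩ and (0,2) + ⟨(2,1)⟩ both miss Λ.
Λ-¬EP2 : ¬ EP2 Γ Λ
Λ-¬EP2 ep2 = Sum.[ from-no (EP-Λ.meetsCoset? (a ∙ a) b) , from-no (EP-Λ.meetsCoset? (a ∙ a) c) ]
                 (ep2 a b c (from-yes (Λ.∈? (a ∙ a ∙ b ∙ c))))
  where
  open FiniteAbelianGroup Γ using (_∙_)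
  a b c : ℕ × ℕ
  a = 0 , 1
  b = 1 , 0
  c = 2 , 1

Γ′ : FiniteAbelianGroup 0ℓ 0ℓ
Γ′ = ℤ/ 4 ℤ

module Λ′ = ListSubset Γ′ ℕ._≟_ (_% 4) (λ x≈y → x≈y) (1 ∷ [])

Λ′ : Subset Γ′ 0ℓ
Λ′ = Λ′.subset

module EP-Λ′ = DecideEP Γ′ Λ′ Λ′.∈? 4 (ℤ/nℤ-annihilated 4)

Λ′-EP2 : EP2 Γ′ Λ′
Λ′-EP2 = from-yes EP-Λ′.EP2?

-- a, b, c = 0, 3, 2: a + b + c = 1 but a + b = 3, and 2a + ⟨2⟩ = 2b + ⟨2⟩ = {0, 2}.
Λ′-¬EP1 : ¬ EP1 Γ′ Λ′
Λ′-¬EP1 ep1 = Sum.[ from-no (Λ′.∈? 3) , Sum.[ from-no (EP-Λ′.meetsCoset? 0 2) , from-no (EP-Λ′.meetsCoset? 6 2) ] ]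
                  (ep1 0 3 2 (from-yes (Λ′.∈? 5)))

proposition1p3 : (Σ (FiniteAbelianGroup 0ℓ 0ℓ) λ Γ → Σ (Subset Γ 0ℓ) λ Λ → EP1 Γ Λ × ¬ EP2 Γ Λ)
    × (Σ (FiniteAbelianGroup 0ℓ 0ℓ) λ Γ′ → Σ (Subset Γ′ 0ℓ) λ Λ′ → EP2 Γ′ Λ′ × ¬ EP1 Γ′ Λ′)
proposition1p3 = (Γ , Λ , Λ-EP1 , Λ-¬EP2) , (Γ′ , Λ′ , Λ′-EP2 , Λ′-¬EP1)
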